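{- Let $R$ be an integral domain of characteristic zero, let $n$ be a positive integer, and let $M=(m_{i,j})\in \operatorname{Frac}(R)^{n\times n}$ be a frieze matrix. Define $m^{k}_{i,j}$ for $0\le k\le n-1$ and $1\le i,j\le n$ as follows: \[ m^0_{i,j}=\begin{cases} m_{2,j} & i=1\\ m_{1,j} & i=2\\ m_{i,j} & i\ge 3,\end{cases}\qquad m^1_{i,j}=\begin{cases} m^0_{i,j} & i=1,2\\ m_{i,j}-\frac{m_{1,i}}{m_{1,2}}m_{2,j} & i\ge 3,\end{cases} \] \[ m^2_{i,j}=\begin{cases} m^0_{i,j} & i=1,2\\ m_{i,j}-\frac{m_{1,i}}{m_{1,2}}m_{2,j}-\frac{m_{2,i}}{m_{1,2}}m_{1,j} & i\ge 3,\end{cases} \] and for $k\ge 3$, \[ m^k_{i,j}=\begin{cases} m^{k-1}_{i,j} & 1\le i\le k\\ m^{k-1}_{i,j}-\frac{m_{1,i}}{m_{1,k}}m^{k-1}_{k,j} & k+1\le i\le n.\end{cases} \] Then for every $k$ with $3\le k\le n-1$: \[ m^k_{i,j}=\begin{cases} m^2_{i,j} & \text{if } i=1,2,\\ 0 & \text{if } i\ge 3 \text{ and } j\le \min\{i-1,k\},\\ \dfrac{ -2m_{1,j}}{m_{1,i-1}}\,m_{i-1,i} & \text{if } 3\le i\le k+1 \text{ and } j\ge i,\\ m^2_{i,j}-\sum_{t=3}^{k}\dfrac{m_{1,i}}{m_{1,t}}\,m^{t-1}_{t,j} & \text{if } i\ge k+2 \text{ and } j\ge k+1.\end{cases} \]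
   Context: A frieze matrix is a symmetric matrix $M=(m_{i,j})\in \operatorname{Frac}(R)^{n\times n}$ (with $\operatorname{Frac}(R)$ the field of fractions of $R$) such that $m_{i,j}=0$ if and only if $i=j$, and whose entries satisfy the generalized diamond rule \[ m_{i,j}m_{i+1,j+1}-m_{i+1,j}m_{i,j+1}=m_{i,i+1}m_{j,j+1} \] for all indices $1\le i$ and $j\ge i+1$ with $j+1\le n$. The superscript $k$ in $m^k_{i,j}$ is an index, not a power. (The $m^k_{i,j}$ are the entries of the matrix obtained from $M$ by swapping its first two rows and then performing the successive row operations $R_i\to R_i-\frac{m_{1,i}}{m_{1,2}}R_1$, $R_i\to R_i-\frac{m_{2,i}}{m_{1,2}}R_2$, and $R_i\to R_i-\frac{m_{1,i}}{m_{1,k}}R_k$ for $k\ge 3$, for the rows $i$ below the pivot row.) -}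

module Defs where

open import Level using (Level; _⊔_; suc)
open import Algebra.Bundles using (CommutativeRing)
open import Data.Nat using (ℕ; zero; _≤?_; _≟_) renaming (suc to 1+)
open import Data.Nat using () renaming (_+_ to _ℕ+_; _∸_ to _ℕ∸_)
open import Relation.Nullary using (¬_; yes; no)
open import Relation.Binary.PropositionalEquality using (_≡_)
open import Data.Bool using (if_then_else_)
open import Data.Nat using (_≤ᵇ_)
open import Data.Nat using (_≤_)

record Field (c ℓ : Level) : Set (Level.suc (c ⊔ ℓ)) where
  field
    commutativeRing : CommutativeRing c ℓ
  open CommutativeRing commutativeRing public
  field
    _⁻¹       : Carrier → Carrier
    ⁻¹-cong   : ∀ {x y} → x ≈ y → x ⁻¹ ≈ y ⁻¹
    0≉1       : ¬ (0# ≈ 1#)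
    ⁻¹-inverse : ∀ x → ¬ (x ≈ 0#) → x * (x ⁻¹) ≈ 1#

  infixl 7 _/_
  _/_ : Carrier → Carrier → Carrier
  x / y = x * (y ⁻¹)

  ι : ℕ → Carrier
  ι zero   = 0#
  ι (1+ n) = 1# + ι n

  CharZero : Set ℓ
  CharZero = ∀ n → ¬ (ι (1+ n) ≈ 0#)

  -- Matrices are indexed by ℕ × ℕ; only entries with 1 ≤ i, j ≤ n matter.
  Mat : Set c
  Mat = ℕ → ℕ → Carrier

  record IsFrieze (n : ℕ) (m : Mat) : Set (c ⊔ ℓ) where
    field
      symmetric : ∀ i j → 1 ≤ i → i ≤ n → 1 ≤ j → j ≤ n → m i j ≈ m j i
      zero-diag : ∀ i → 1 ≤ i → i ≤ n → m i i ≈ 0#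
      nonzero-off : ∀ i j → 1 ≤ i → i ≤ n → 1 ≤ j → j ≤ n → ¬ (i ≡ j) → ¬ (m i j ≈ 0#)
      diamond : ∀ i j → 1 ≤ i → 1+ i ≤ j → 1+ j ≤ n →
        m i j * m (1+ i) (1+ j) - m (1+ i) j * m i (1+ j)
          ≈ m i (1+ i) * m j (1+ j)

  m0 : Mat → Mat
  m0 m 1 j = m 2 j
  m0 m 2 j = m 1 j
  m0 m i j = m i j

  mk : Mat → ℕ → Mat
  mk m 0 i j = m0 m i j
  mk m 1 i j =
    if i ≤ᵇ 2 then m0 m i j
    else m i j - (m 1 i / m 1 2) * m 2 j
  mk m 2 i j =
    if i ≤ᵇ 2 then m0 m i j
    else m i j - (m 1 i / m 1 2) * m 2 j - (m 2 i / m 1 2) * m 1 j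
  mk m (1+ p@(1+ (1+ _))) i j =
    if i ≤ᵇ 1+ p then mk m p i j
    else mk m p i j - (m 1 i / m 1 (1+ p)) * mk m p (1+ p) j

  -- ∑_{t=a}^{b} f t  (empty, i.e. 0#, when b < a)
  sumFromTo : ℕ → ℕ → (ℕ → Carrier) → Carrier
  sumFromTo a b f = go (1+ b ℕ∸ a) a
    where
    go : ℕ → ℕ → Carrier
    go zero     t = 0#
    go (1+ r) t = f t + go r (1+ t)

-- Write A j = m 1 j, B j = m 2 j and Y j = B j / (A 2 · A j).  Comparing the
-- diamond rule with the three-term Plücker relation for the 2 × 2 minors of the
-- rows A and B gives, by induction, the Ptolemy relation
-- A 2 · m p q = A p B q − A q B p for 2 ≤ p ≤ q, i.e. m p q = A p A q (Y q − Y p).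
-- In these coordinates every entry m^k_{i,j} with k ≥ 2 and i ≥ 3 equals
-- 2 A i A j (Y p − Y q) with p = min (k, i − 1, j) and q = min (i, j): the
-- elimination step k → k + 1 only turns Y (min (k, j)) into Y (min (k + 1, j))
-- in the rows below k + 1.  The second and third cases of the theorem are
-- instances of this closed form; the first and the last only unfold the
-- recursion defining m^k.

module Submission where

open import Defs
open import Data.Nat using (ℕ; _≤_; _∸_) renaming (suc to 1+; _+_ to _ℕ+_)
open import Data.Product using (_×_)
open import Algebra.Bundles using (CommutativeRing; RawRing)
open import Algebra.Solver.Ring.AlmostCommutativeRing
  using (fromCommutativeRing; _-Raw-AlmostCommutative⟶_)
import Data.Nat as ℕ
import Data.Nat.Properties as ℕ
open import Data.Nat using (_<_; _⊓_; _≤ᵇ_; s≤s; z≤n; _≤‴_; ≤‴-refl; ≤‴-step)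
open import Data.Bool using (true; false)
open import Data.Empty using (⊥-elim)
open import Data.Maybe using (Maybe; just; nothing)
open import Data.Product using (_,_)
open import Data.Sum using (inj₁; inj₂)
open import Relation.Binary.PropositionalEquality using (_≡_; cong; cong₂)
import Relation.Binary.PropositionalEquality as ≡
open import Relation.Nullary using (¬_; yes; no)

-- The solvers of the library decide equality of coefficients; integer
-- coefficients are available in every commutative ring as pairs (p , q) of
-- naturals denoting p · 1 − q · 1.
module RingSolver {c ℓ} (R : CommutativeRing c ℓ) where
  open CommutativeRing R
  open import Algebra.Properties.Ring ring
    using ( -0#≈0#; -‿involutive; -‿+-comm; ⁻¹-anti-homo‿-; x∙y⁻¹≈ε⇒x≈y
          ; [y-z]x≈yx-zx; x[y-z]≈xy-xz)
  open import Algebra.Properties.CommutativeSemigroup +-commutativeSemigroup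
    using (interchange)
  open import Algebra.Properties.Semiring.Mult semiring
    using (×-homo-+; ×1-homo-*) renaming (_×_ to _·_)
  open import Relation.Binary.Reasoning.Setoid setoid

  ℕ-differences : RawRing _ _
  ℕ-differences = record
    { Carrier = ℕ × ℕ
    ; _≈_ = _≡_
    ; _+_ = λ { (p , q) (p′ , q′) → (p ℕ+ p′ , q ℕ+ q′) }
    ; _*_ = λ { (p , q) (p′ , q′) → (p ℕ.* p′ ℕ+ q ℕ.* q′ , p ℕ.* q′ ℕ+ q ℕ.* p′) }
    ; -_ = λ { (p , q) → (q , p) }
    ; 0# = (0 , 0)
    ; 1# = (1 , 0)
    }

  ⟦_⟧ᶜ : ℕ × ℕ → Carrier
  ⟦ p , q ⟧ᶜ = p · 1# - q · 1#

  [x-y]-[z-w]≈[x+w]-[z+y] : ∀ x y z w → (x - y) - (z - w) ≈ (x + w) - (z + y)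
  [x-y]-[z-w]≈[x+w]-[z+y] x y z w = begin
    (x - y) - (z - w)     ≈⟨ +-congˡ (-‿+-comm z (- w)) ⟨
    (x - y) + (- z - - w) ≈⟨ +-congˡ (trans (+-congˡ (-‿involutive w)) (+-comm (- z) w)) ⟩
    (x - y) + (w - z)     ≈⟨ interchange x (- y) w (- z) ⟩
    (x + w) + (- y - z)   ≈⟨ +-congˡ (trans (+-comm (- y) (- z)) (-‿+-comm z y)) ⟩
    (x + w) - (z + y)     ∎

  ⟦⟧ᶜ-homo-+ : ∀ x y → ⟦ RawRing._+_ ℕ-differences x y ⟧ᶜ ≈ ⟦ x ⟧ᶜ + ⟦ y ⟧ᶜ
  ⟦⟧ᶜ-homo-+ (p , q) (p′ , q′) = begin
    (p ℕ+ p′) · 1# - (q ℕ+ q′) · 1#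
      ≈⟨ +-cong (×-homo-+ 1# p p′) (-‿cong (×-homo-+ 1# q q′)) ⟩
    (p · 1# + p′ · 1#) - (q · 1# + q′ · 1#)     ≈⟨ +-congˡ (-‿+-comm _ _) ⟨
    (p · 1# + p′ · 1#) + (- (q · 1#) - q′ · 1#) ≈⟨ interchange _ _ _ _ ⟩
    (p · 1# - q · 1#) + (p′ · 1# - q′ · 1#)     ∎

  ⟦⟧ᶜ-homo-* : ∀ x y → ⟦ RawRing._*_ ℕ-differences x y ⟧ᶜ ≈ ⟦ x ⟧ᶜ * ⟦ y ⟧ᶜ
  ⟦⟧ᶜ-homo-* (p , q) (p′ , q′) = begin
    (p ℕ.* p′ ℕ+ q ℕ.* q′) · 1# - (p ℕ.* q′ ℕ+ q ℕ.* p′) · 1#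
      ≈⟨ +-cong (·-homo p p′ q q′) (-‿cong (·-homo p q′ q p′)) ⟩
    (P * P′ + Q * Q′) - (P * Q′ + Q * P′) ≈⟨ [x-y]-[z-w]≈[x+w]-[z+y] _ _ _ _ ⟨
    (P * P′ - Q * P′) - (P * Q′ - Q * Q′)
      ≈⟨ +-cong ([y-z]x≈yx-zx P′ P Q) (-‿cong ([y-z]x≈yx-zx Q′ P Q)) ⟨
    (P - Q) * P′ - (P - Q) * Q′           ≈⟨ x[y-z]≈xy-xz (P - Q) P′ Q′ ⟨
    (P - Q) * (P′ - Q′)                   ∎
    where
    P = p · 1#
    Q = q · 1#
    P′ = p′ · 1#
    Q′ = q′ · 1#
    ·-homo : ∀ a b c d → (a ℕ.* b ℕ+ c ℕ.* d) · 1# ≈ a · 1# * b · 1# + c · 1# * d · 1#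
    ·-homo a b c d =
      trans (×-homo-+ 1# (a ℕ.* b) (c ℕ.* d)) (+-cong (×1-homo-* a b) (×1-homo-* c d))

  homomorphism : ℕ-differences -Raw-AlmostCommutative⟶ fromCommutativeRing R
  homomorphism = record
    { ⟦_⟧ = ⟦_⟧ᶜ
    ; +-homo = ⟦⟧ᶜ-homo-+
    ; *-homo = ⟦⟧ᶜ-homo-*
    ; -‿homo = λ { (p , q) → sym (⁻¹-anti-homo‿- (p · 1#) (q · 1#)) }
    ; 0-homo = -‿inverseʳ 0#
    ; 1-homo = trans (+-cong (+-identityʳ 1#) -0#≈0#) (+-identityʳ 1#)
    }

  ⟦⟧ᶜ-equal? : ∀ x y → Maybe (⟦ x ⟧ᶜ ≈ ⟦ y ⟧ᶜ)
  ⟦⟧ᶜ-equal? (p , q) (p′ , q′) with p ℕ+ q′ ℕ.≟ p′ ℕ+ q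
  ... | no _ = nothing
  ... | yes p+q′≡p′+q = just (x∙y⁻¹≈ε⇒x≈y _ _ (begin
    (p · 1# - q · 1#) - (p′ · 1# - q′ · 1#) ≈⟨ [x-y]-[z-w]≈[x+w]-[z+y] _ _ _ _ ⟩
    (p · 1# + q′ · 1#) - (p′ · 1# + q · 1#)
      ≈⟨ +-cong (×-homo-+ 1# p q′) (-‿cong (×-homo-+ 1# p′ q)) ⟨
    (p ℕ+ q′) · 1# - (p′ ℕ+ q) · 1#
      ≡⟨ cong (λ r → r · 1# - (p′ ℕ+ q) · 1#) p+q′≡p′+q ⟩
    (p′ ℕ+ q) · 1# - (p′ ℕ+ q) · 1#         ≈⟨ -‿inverseʳ _ ⟩
    0#                                      ∎))

  open import Algebra.Solver.Ring ℕ-differences (fromCommutativeRing R) homomorphism ⟦⟧ᶜ-equal?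
    public using (solve; _:=_; _:+_; _:*_; _:-_; :-_)

module FieldProperties {c ℓ} (F : Field c ℓ) where
  open Field F
  open RingSolver commutativeRing using (solve; _:=_; _:+_; _:*_; _:-_)
  open import Algebra.Properties.Ring ring using (-0#≈0#)
  open import Relation.Binary.Reasoning.Setoid setoid

  x/z*z≈x : ∀ {z} x → ¬ (z ≈ 0#) → x / z * z ≈ x
  x/z*z≈x {z} x z≉0 = begin
    x * z ⁻¹ * z   ≈⟨ solve 3 (λ x w z → x :* w :* z := x :* (z :* w)) refl x (z ⁻¹) z ⟩
    x * (z * z ⁻¹) ≈⟨ *-congˡ (⁻¹-inverse z z≉0) ⟩
    x * 1#         ≈⟨ *-identityʳ x ⟩
    x              ∎

  z*[x/z]≈x : ∀ {z} x → ¬ (z ≈ 0#) → z * (x / z) ≈ x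
  z*[x/z]≈x x z≉0 = trans (*-comm _ _) (x/z*z≈x x z≉0)

  [z*x]/z≈x : ∀ {z} x → ¬ (z ≈ 0#) → z * x / z ≈ x
  [z*x]/z≈x {z} x z≉0 =
    trans (solve 3 (λ z x w → z :* x :* w := x :* w :* z) refl z x (z ⁻¹)) (x/z*z≈x x z≉0)

  x/z*[z*y]≈x*y : ∀ {z} x y → ¬ (z ≈ 0#) → x / z * (z * y) ≈ x * y
  x/z*[z*y]≈x*y {z} x y z≉0 = begin
    x * z ⁻¹ * (z * y)
      ≈⟨ solve 4 (λ x w z y → x :* w :* (z :* y) := x :* w :* z :* y) refl x (z ⁻¹) z y ⟩
    x / z * z * y      ≈⟨ *-congʳ (x/z*z≈x x z≉0) ⟩
    x * y              ∎

  *-cancelˡ : ∀ {z x y} → ¬ (z ≈ 0#) → z * x ≈ z * y → x ≈ y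
  *-cancelˡ {z} {x} {y} z≉0 zx≈zy = begin
    x         ≈⟨ [z*x]/z≈x x z≉0 ⟨
    z * x / z ≈⟨ *-congʳ zx≈zy ⟩
    z * y / z ≈⟨ [z*x]/z≈x y z≉0 ⟩
    y         ∎

  *-nonzero : ∀ {x y} → ¬ (x ≈ 0#) → ¬ (y ≈ 0#) → ¬ (x * y ≈ 0#)
  *-nonzero {x} x≉0 y≉0 xy≈0 = y≉0 (*-cancelˡ x≉0 (trans xy≈0 (sym (zeroʳ x))))

  x-0≈x : ∀ {x} → x - 0# ≈ x
  x-0≈x {x} = trans (+-congˡ -0#≈0#) (+-identityʳ x)

  x-y≈z⇒x≈y+z : ∀ {x y z} → x - y ≈ z → x ≈ y + z
  x-y≈z⇒x≈y+z {x} {y} x-y≈z =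
    trans (solve 2 (λ x y → x := y :+ (x :- y)) refl x y) (+-congˡ x-y≈z)

  ι2*x≈x+x : ∀ x → ι 2 * x ≈ x + x
  ι2*x≈x+x x = begin
    (1# + (1# + 0#)) * x ≈⟨ *-congʳ (+-congˡ (+-identityʳ 1#)) ⟩
    (1# + 1#) * x        ≈⟨ distribʳ x 1# 1# ⟩
    1# * x + 1# * x      ≈⟨ +-cong (*-identityˡ x) (*-identityˡ x) ⟩
    x + x                ∎

module SumFromToProperties {c ℓ} (F : Field c ℓ) where
  open Field F
  open import Relation.Binary.Reasoning.Setoid setoid

  -- sumFromTo t b f is a recursion on the number 1 + b ∸ t of terms.
  sumFromTo-cons : ∀ f {t b} → t ≤ b → sumFromTo t b f ≡ f t + sumFromTo (1+ t) b f
  sumFromTo-cons f {t} {b} t≤b with 1+ b ∸ t | ℕ.+-∸-assoc 1 t≤b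
  ... | _ | ≡.refl = ≡.refl

  sumFromTo-empty : ∀ f {t b} → b < t → sumFromTo t b f ≡ 0#
  sumFromTo-empty f {t} {b} b<t with 1+ b ∸ t | ℕ.m≤n⇒m∸n≡0 b<t
  ... | _ | ≡.refl = ≡.refl

  sumFromTo-snoc : ∀ f {t b} → t ≤ 1+ b → sumFromTo t (1+ b) f ≈ sumFromTo t b f + f (1+ b)
  sumFromTo-snoc f t≤b+1 = snoc (ℕ.≤⇒≤‴ t≤b+1)
    where
    snoc : ∀ {t b} → t ≤‴ 1+ b → sumFromTo t (1+ b) f ≈ sumFromTo t b f + f (1+ b)
    snoc {b = b} ≤‴-refl = begin
      sumFromTo (1+ b) (1+ b) f              ≡⟨ sumFromTo-cons f ℕ.≤-refl ⟩
      f (1+ b) + sumFromTo (2 ℕ+ b) (1+ b) f ≡⟨ cong (f (1+ b) +_) (sumFromTo-empty f {2 ℕ+ b} ℕ.≤-refl) ⟩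
      f (1+ b) + 0#                          ≈⟨ +-comm _ _ ⟩
      0# + f (1+ b)                          ≡⟨ cong (_+ f (1+ b)) (sumFromTo-empty f {1+ b} ℕ.≤-refl) ⟨
      sumFromTo (1+ b) b f + f (1+ b)        ∎
    snoc {t} {b} (≤‴-step t<b+1) = begin
      sumFromTo t (1+ b) f                    ≡⟨ sumFromTo-cons f (ℕ.<⇒≤ t<b+1′) ⟩
      f t + sumFromTo (1+ t) (1+ b) f         ≈⟨ +-congˡ (snoc t<b+1) ⟩
      f t + (sumFromTo (1+ t) b f + f (1+ b)) ≈⟨ +-assoc _ _ _ ⟨
      f t + sumFromTo (1+ t) b f + f (1+ b)   ≡⟨ cong (_+ f (1+ b)) (sumFromTo-cons f (ℕ.≤-pred t<b+1′)) ⟨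
      sumFromTo t b f + f (1+ b)              ∎
      where
      t<b+1′ : t < 1+ b
      t<b+1′ = ℕ.≤‴⇒≤ t<b+1

module Elimination {c ℓ} (F : Field c ℓ) where
  open Field F
  open FieldProperties F
  open SumFromToProperties F
  open RingSolver commutativeRing using (solve; _:=_; _:+_; _:*_; _:-_; :-_)
  open import Relation.Binary.Reasoning.Setoid setoid

  mk-suc-≤ : ∀ m {k i} j → 2 ≤ k → i ≤ 1+ k → mk m (1+ k) i j ≡ mk m k i j
  mk-suc-≤ m {i = i} j (s≤s (s≤s {n = k} _)) i≤k+1 with i ≤ᵇ 3 ℕ+ k | ℕ.≤⇒≤ᵇ i≤k+1
  ... | true | _ = ≡.refl

  mk-suc-> : ∀ m {k i} j → 2 ≤ k → 1+ k < i →
    mk m (1+ k) i j ≡ mk m k i j - (m 1 i / m 1 (1+ k)) * mk m k (1+ k) j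
  mk-suc-> m {i = i} j (s≤s (s≤s {n = k} _)) k+1<i with i ≤ᵇ 3 ℕ+ k | ℕ.≤ᵇ⇒≤ i (3 ℕ+ k)
  ... | false | _ = ≡.refl
  ... | true | i≤k+1 = ⊥-elim (ℕ.<⇒≱ k+1<i (i≤k+1 _))

  mk-top-rows : ∀ m {k i} j → 2 ≤ k → i ≤ 2 → mk m k i j ≡ mk m 2 i j
  mk-top-rows m {1} j (s≤s ()) _
  mk-top-rows m {2} j _ _ = ≡.refl
  mk-top-rows m {1+ k@(1+ (1+ _))} j _ i≤2 =
    ≡.trans (mk-suc-≤ m j 2≤k (ℕ.≤-trans i≤2 (ℕ.m≤n⇒m≤1+n 2≤k))) (mk-top-rows m j 2≤k i≤2)
    where
    2≤k : 2 ≤ k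
    2≤k = s≤s (s≤s z≤n)

  mk-unfold : ∀ m {k i} j → 2 ≤ k → 1+ k ≤ i →
    mk m k i j ≈ mk m 2 i j - sumFromTo 3 k (λ t → (m 1 i / m 1 t) * mk m (t ∸ 1) t j)
  mk-unfold m {1} j (s≤s ()) _
  mk-unfold m {2} j _ _ = sym x-0≈x
  mk-unfold m {1+ k@(1+ (1+ _))} {i} j _ k+1<i = begin
    mk m (1+ k) i j                                   ≡⟨ mk-suc-> m j 2≤k k+1<i ⟩
    mk m k i j - pivot (1+ k)                         ≈⟨ +-congʳ (mk-unfold m j 2≤k (ℕ.<⇒≤ k+1<i)) ⟩
    mk m 2 i j - sumFromTo 3 k pivot - pivot (1+ k)   ≈⟨ x-s-y≈x-[s+y] _ _ _ ⟩
    mk m 2 i j - (sumFromTo 3 k pivot + pivot (1+ k)) ≈⟨ +-congˡ (-‿cong (sumFromTo-snoc pivot (s≤s 2≤k))) ⟨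
    mk m 2 i j - sumFromTo 3 (1+ k) pivot             ∎
    where
    2≤k : 2 ≤ k
    2≤k = s≤s (s≤s z≤n)
    pivot : ℕ → Carrier
    pivot t = (m 1 i / m 1 t) * mk m (t ∸ 1) t j
    x-s-y≈x-[s+y] : ∀ x s y → x - s - y ≈ x - (s + y)
    x-s-y≈x-[s+y] = solve 3 (λ x s y → x :- s :- y := x :- (s :+ y)) refl

  module FriezeCoordinates {n : ℕ} {m : Mat} (fr : IsFrieze n m) (2≤n : 2 ≤ n) where
    open IsFrieze fr

    A B Y : ℕ → Carrier
    A j = m 1 j
    B j = m 2 j
    Y j = B j / (A 2 * A j)

    A≉0 : ∀ {p} → 2 ≤ p → p ≤ n → ¬ (A p ≈ 0#)
    A≉0 {p} 2≤p p≤n = nonzero-off 1 p ℕ.≤-refl (ℕ.≤-trans (ℕ.n≤1+n 1) 2≤n)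
      (ℕ.≤-trans (ℕ.n≤1+n 1) 2≤p) p≤n (ℕ.<⇒≢ 2≤p)

    A₂≉0 : ¬ (A 2 ≈ 0#)
    A₂≉0 = A≉0 ℕ.≤-refl 2≤n

    B≈A₂*A*Y : ∀ {p} → 2 ≤ p → p ≤ n → B p ≈ A 2 * A p * Y p
    B≈A₂*A*Y 2≤p p≤n = sym (z*[x/z]≈x _ (*-nonzero A₂≉0 (A≉0 2≤p p≤n)))

    Y₂≈0 : Y 2 ≈ 0#
    Y₂≈0 = trans (*-congʳ (zero-diag 2 (s≤s z≤n) 2≤n)) (zeroˡ _)

    minor : ℕ → ℕ → Carrier
    minor p q = A p * B q - A q * B p

    minor-plücker : ∀ i i′ j j′ →
      minor i j * minor i′ j′ ≈ minor i′ j * minor i j′ + minor i i′ * minor j j′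
    minor-plücker i i′ j j′ = solve 8
      (λ a a′ b b′ c c′ d d′ →
        (a :* c′ :- c :* a′) :* (b :* d′ :- d :* b′)
          := (b :* c′ :- c :* b′) :* (a :* d′ :- d :* a′) :+ (a :* b′ :- b :* a′) :* (c :* d′ :- d :* c′))
      refl (A i) (B i) (A i′) (B i′) (A j) (B j) (A j′) (B j′)

    Ptolemy : ℕ → ℕ → Set ℓ
    Ptolemy p q = A 2 * m p q ≈ minor p q

    ptolemy-row₂ : ∀ q → Ptolemy 2 q
    ptolemy-row₂ q = begin
      A 2 * m 2 q           ≈⟨ x-0≈x ⟨
      A 2 * B q - 0#        ≈⟨ +-congˡ (-‿cong (trans (*-congˡ (zero-diag 2 (s≤s z≤n) 2≤n)) (zeroʳ _))) ⟨
      A 2 * B q - A q * B 2 ∎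

    ptolemy-diagonal : ∀ {p} → 1 ≤ p → p ≤ n → Ptolemy p p
    ptolemy-diagonal {p} 1≤p p≤n = begin
      A 2 * m p p ≈⟨ *-congˡ (zero-diag p 1≤p p≤n) ⟩
      A 2 * 0#    ≈⟨ zeroʳ _ ⟩
      0#          ≈⟨ -‿inverseʳ _ ⟨
      minor p p   ∎

    ptolemy-superdiagonal : ∀ {p} → 2 ≤ p → 1+ p ≤ n → Ptolemy p (1+ p)
    ptolemy-superdiagonal {p} 2≤p p<n = begin
      A 2 * m p (1+ p)                ≈⟨ diamond 1 p ℕ.≤-refl 2≤p p<n ⟨
      A p * B (1+ p) - B p * A (1+ p) ≈⟨ +-congˡ (-‿cong (*-comm _ _)) ⟩
      minor p (1+ p)                  ∎

    -- A 2 · m satisfies the diamond rule and minor the Plücker relation, which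
    -- has the same shape; so agreement at the three entries above and to the
    -- left of (i + 1, j + 1) propagates to it, as minor i j ≠ 0.
    ptolemy-step : ∀ {i j} → 2 ≤ i → 2 ℕ+ i ≤ j → 1+ j ≤ n →
      Ptolemy i j → Ptolemy (1+ i) j → Ptolemy i (1+ j) → Ptolemy (1+ i) (1+ j)
    ptolemy-step {i} {j} 2≤i i+2≤j j<n pt-ij pt-i′j pt-ij′ = *-cancelˡ minor≉0 (begin
      minor i j * (A 2 * m i′ j′)                       ≈⟨ *-congʳ pt-ij ⟨
      A 2 * m i j * (A 2 * m i′ j′)                     ≈⟨ regroup₁ _ _ _ ⟩
      A 2 * A 2 * (m i j * m i′ j′)                     ≈⟨ *-congˡ (x-y≈z⇒x≈y+z (diamond i j 1≤i i<j j<n)) ⟩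
      A 2 * A 2 * (m i′ j * m i j′ + m i i′ * m j j′)   ≈⟨ regroup₂ _ _ _ _ _ ⟩
      A 2 * m i′ j * (A 2 * m i j′) + A 2 * m i i′ * (A 2 * m j j′)
        ≈⟨ +-cong (*-cong pt-i′j pt-ij′) (*-cong pt-ii′ pt-jj′) ⟩
      minor i′ j * minor i j′ + minor i i′ * minor j j′ ≈⟨ minor-plücker i i′ j j′ ⟨
      minor i j * minor i′ j′                           ∎)
      where
      i′ = 1+ i
      j′ = 1+ j
      i<j : 1+ i ≤ j
      i<j = ℕ.m+n≤o⇒n≤o 1 i+2≤j
      i≤j : i ≤ j
      i≤j = ℕ.<⇒≤ i<j
      1≤i : 1 ≤ i
      1≤i = ℕ.≤-trans (ℕ.n≤1+n 1) 2≤i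
      j≤n : j ≤ n
      j≤n = ℕ.<⇒≤ j<n
      pt-ii′ : Ptolemy i i′
      pt-ii′ = ptolemy-superdiagonal 2≤i (ℕ.≤-trans i<j j≤n)
      pt-jj′ : Ptolemy j j′
      pt-jj′ = ptolemy-superdiagonal (ℕ.≤-trans 2≤i i≤j) j<n
      minor≉0 : ¬ (minor i j ≈ 0#)
      minor≉0 minor≈0 = *-nonzero A₂≉0
        (nonzero-off i j 1≤i (ℕ.≤-trans i≤j j≤n) (ℕ.≤-trans 1≤i i≤j) j≤n (ℕ.<⇒≢ i<j))
        (trans pt-ij minor≈0)
      regroup₁ : ∀ a x y → a * x * (a * y) ≈ a * a * (x * y)
      regroup₁ = solve 3 (λ a x y → a :* x :* (a :* y) := a :* a :* (x :* y)) refl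
      regroup₂ : ∀ a w x y z → a * a * (w * x + y * z) ≈ a * w * (a * x) + a * y * (a * z)
      regroup₂ = solve 5
        (λ a w x y z → a :* a :* (w :* x :+ y :* z) := a :* w :* (a :* x) :+ a :* y :* (a :* z)) refl

    -- The row index is written 2 + i so that this recursion, lexicographic in
    -- the column and then the row, is structural.
    ptolemy′ : ∀ q i → 2 ℕ+ i ≤ q → q ≤ n → Ptolemy (2 ℕ+ i) q
    ptolemy′ q 0 _ _ = ptolemy-row₂ q
    ptolemy′ 0 (1+ i) () _
    ptolemy′ (1+ j) (1+ i) p≤q q≤n with 2 ℕ+ i ℕ.≟ j
    ... | yes ≡.refl = ptolemy-diagonal (s≤s z≤n) q≤n
    ... | no p≢q with 3 ℕ+ i ℕ.≟ j
    ...   | yes ≡.refl = ptolemy-superdiagonal (s≤s (s≤s z≤n)) q≤n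
    ...   | no p+1≢q = ptolemy-step (s≤s (s≤s z≤n)) p+2≤q q≤n
            (ptolemy′ j i (ℕ.m+n≤o⇒n≤o 2 p+2≤q) j≤n)
            (ptolemy′ j (1+ i) (ℕ.m+n≤o⇒n≤o 1 p+2≤q) j≤n)
            (ptolemy′ (1+ j) i (ℕ.m≤n⇒m≤1+n (ℕ.m+n≤o⇒n≤o 2 p+2≤q)) q≤n)
      where
      p+2≤q : 4 ℕ+ i ≤ j
      p+2≤q = ℕ.≤∧≢⇒< (ℕ.≤∧≢⇒< (ℕ.≤-pred p≤q) p≢q) p+1≢q
      j≤n : j ≤ n
      j≤n = ℕ.<⇒≤ q≤n

    ptolemy : ∀ {p q} → 2 ≤ p → p ≤ q → q ≤ n → Ptolemy p q
    ptolemy {q = q} (s≤s (s≤s {n = i} _)) = ptolemy′ q i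

    entry : ∀ {p q} → 2 ≤ p → p ≤ q → q ≤ n → m p q ≈ A p * A q * (Y q - Y p)
    entry {p} {q} 2≤p p≤q q≤n = *-cancelˡ A₂≉0 (begin
      A 2 * m p q                                       ≈⟨ ptolemy 2≤p p≤q q≤n ⟩
      A p * B q - A q * B p
        ≈⟨ +-cong (*-congˡ (B≈A₂*A*Y (ℕ.≤-trans 2≤p p≤q) q≤n))
                  (-‿cong (*-congˡ (B≈A₂*A*Y 2≤p (ℕ.≤-trans p≤q q≤n)))) ⟩
      A p * (A 2 * A q * Y q) - A q * (A 2 * A p * Y p) ≈⟨ factor _ _ _ _ _ ⟩
      A 2 * (A p * A q * (Y q - Y p))                   ∎)
      where
      factor : ∀ a₂ a b y z → a * (a₂ * b * z) - b * (a₂ * a * y) ≈ a₂ * (a * b * (z - y))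
      factor = solve 5
        (λ a₂ a b y z → a :* (a₂ :* b :* z) :- b :* (a₂ :* a :* y) := a₂ :* (a :* b :* (z :- y))) refl

    Δ : ℕ → ℕ → ℕ → ℕ → Carrier
    Δ i j p q = ι 2 * (A i * A j * (Y p - Y q))

    Δ-diagonal : ∀ i j p → Δ i j p p ≈ 0#
    Δ-diagonal i j p = trans (*-congˡ (trans (*-congˡ (-‿inverseʳ (Y p))) (zeroʳ _))) (zeroʳ _)

    Δ-row₂ : ∀ i j q → Δ i j 2 q ≈ - (A i * A j * Y q + A i * A j * Y q)
    Δ-row₂ i j q = begin
      ι 2 * (A i * A j * (Y 2 - Y q))       ≈⟨ *-congˡ (*-congˡ (trans (+-congʳ Y₂≈0) (+-identityˡ _))) ⟩
      ι 2 * (A i * A j * - Y q)             ≈⟨ ι2*x≈x+x _ ⟩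
      A i * A j * - Y q + A i * A j * - Y q ≈⟨ collect _ _ _ ⟩
      - (A i * A j * Y q + A i * A j * Y q) ∎
      where
      collect : ∀ a b y → a * b * - y + a * b * - y ≈ - (a * b * y + a * b * y)
      collect = solve 3 (λ a b y → a :* b :* (:- y) :+ a :* b :* (:- y) := :- (a :* b :* y :+ a :* b :* y)) refl

    Δ-eliminate : ∀ i j r p q s → ¬ (A r ≈ 0#) → Δ i j p q - A i / A r * Δ r j p s ≈ Δ i j s q
    Δ-eliminate i j r p q s A≉0 = begin
      Δ i j p q - A i / A r * Δ r j p s
        ≈⟨ +-congˡ (-‿cong (*-congˡ (pull-out _ _ _ _ _))) ⟩
      Δ i j p q - A i / A r * (A r * (ι 2 * (A j * (Y p - Y s))))
        ≈⟨ +-congˡ (-‿cong (x/z*[z*y]≈x*y _ _ A≉0)) ⟩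
      Δ i j p q - A i * (ι 2 * (A j * (Y p - Y s)))
        ≈⟨ telescope _ _ _ _ _ _ ⟩
      Δ i j s q ∎
      where
      pull-out : ∀ c a b y z → c * (a * b * (y - z)) ≈ a * (c * (b * (y - z)))
      pull-out = solve 5 (λ c a b y z → c :* (a :* b :* (y :- z)) := a :* (c :* (b :* (y :- z)))) refl
      telescope : ∀ c a b y z w → c * (a * b * (y - z)) - a * (c * (b * (y - w))) ≈ c * (a * b * (w - z))
      telescope = solve 6
        (λ c a b y z w → c :* (a :* b :* (y :- z)) :- a :* (c :* (b :* (y :- w))) := c :* (a :* b :* (w :- z)))
        refl

    Δ-superdiagonal : ∀ {h} j → 2 ≤ h → 1+ h ≤ n →
      Δ (1+ h) j h (1+ h) ≈ (- (ι 2 * A j)) / A h * m h (1+ h)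
    Δ-superdiagonal {h} j 2≤h h<n = sym (begin
      (- (ι 2 * A j)) / A h * m h (1+ h)
        ≈⟨ *-congˡ (trans (entry 2≤h (ℕ.n≤1+n h) h<n) (*-assoc _ _ _)) ⟩
      (- (ι 2 * A j)) / A h * (A h * (A (1+ h) * (Y (1+ h) - Y h)))
        ≈⟨ x/z*[z*y]≈x*y _ _ (A≉0 2≤h (ℕ.<⇒≤ h<n)) ⟩
      (- (ι 2 * A j)) * (A (1+ h) * (Y (1+ h) - Y h))
        ≈⟨ rearrange _ _ _ _ _ ⟩
      Δ (1+ h) j h (1+ h) ∎)
      where
      rearrange : ∀ c b a y z → (- (c * b)) * (a * (z - y)) ≈ c * (a * b * (y - z))
      rearrange = solve 5 (λ c b a y z → (:- (c :* b)) :* (a :* (z :- y)) := c :* (a :* b :* (y :- z))) refl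

    mk₂-expand : ∀ {i j} → 3 ≤ i → i ≤ n → 2 ≤ j → j ≤ n →
      mk m 2 i j ≈ m i j - A i * (A j * Y j) - A i * Y i * A j
    mk₂-expand {i} {j} 3≤i@(s≤s (s≤s (s≤s _))) i≤n 2≤j j≤n =
      +-cong (+-congˡ (-‿cong pivot-row₂)) (-‿cong pivot-row₁)
      where
      pivot-row₂ : A i / A 2 * B j ≈ A i * (A j * Y j)
      pivot-row₂ = trans (*-congˡ (trans (B≈A₂*A*Y 2≤j j≤n) (*-assoc _ _ _))) (x/z*[z*y]≈x*y _ _ A₂≉0)
      pivot-row₁ : B i / A 2 * A j ≈ A i * Y i * A j
      pivot-row₁ = *-congʳ (trans (*-congʳ (trans (B≈A₂*A*Y (ℕ.≤-trans (ℕ.n≤1+n 2) 3≤i) i≤n)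
                                                  (*-assoc _ _ _)))
                                  ([z*x]/z≈x _ A₂≉0))

    mk₂-column₁ : ∀ {i} → 3 ≤ i → i ≤ n → mk m 2 i 1 ≈ 0#
    mk₂-column₁ {i} (s≤s (s≤s (s≤s _))) i≤n = begin
      m i 1 - A i / A 2 * B 1 - B i / A 2 * A 1
        ≈⟨ +-cong (+-cong (symmetric i 1 (s≤s z≤n) i≤n ℕ.≤-refl 1≤n)
                          (-‿cong (*-congˡ (symmetric 2 1 (s≤s z≤n) 2≤n ℕ.≤-refl 1≤n))))
                  (-‿cong (*-congˡ (zero-diag 1 ℕ.≤-refl 1≤n))) ⟩
      A i - A i / A 2 * A 2 - B i / A 2 * 0#
        ≈⟨ +-cong (+-congˡ (-‿cong (x/z*z≈x _ A₂≉0))) (-‿cong (zeroʳ _)) ⟩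
      A i - A i - 0#                         ≈⟨ trans x-0≈x (-‿inverseʳ _) ⟩
      0#                                     ∎
      where
      1≤n : 1 ≤ n
      1≤n = ℕ.≤-trans (ℕ.n≤1+n 1) 2≤n

    mk₂-closed : ∀ {i j} → 3 ≤ i → i ≤ n → 2 ≤ j → j ≤ n → mk m 2 i j ≈ Δ i j 2 (i ⊓ j)
    mk₂-closed {i} {j} 3≤i i≤n 2≤j j≤n with ℕ.≤-total i j
    ... | inj₁ i≤j = begin
      mk m 2 i j                                                    ≈⟨ mk₂-expand 3≤i i≤n 2≤j j≤n ⟩
      m i j - A i * (A j * Y j) - A i * Y i * A j                   ≈⟨ +-congʳ (+-congʳ (entry 2≤i i≤j j≤n)) ⟩
      A i * A j * (Y j - Y i) - A i * (A j * Y j) - A i * Y i * A j ≈⟨ collect _ _ _ _ ⟩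
      - (A i * A j * Y i + A i * A j * Y i)                         ≈⟨ Δ-row₂ i j i ⟨
      Δ i j 2 i                                                     ≡⟨ cong (Δ i j 2) (ℕ.m≤n⇒m⊓n≡m i≤j) ⟨
      Δ i j 2 (i ⊓ j)                                               ∎
      where
      2≤i : 2 ≤ i
      2≤i = ℕ.≤-trans (ℕ.n≤1+n 2) 3≤i
      collect : ∀ a b y z → a * b * (z - y) - a * (b * z) - a * y * b ≈ - (a * b * y + a * b * y)
      collect = solve 4
        (λ a b y z → a :* b :* (z :- y) :- a :* (b :* z) :- a :* y :* b := :- (a :* b :* y :+ a :* b :* y)) refl
    ... | inj₂ j≤i = begin
      mk m 2 i j                                                    ≈⟨ mk₂-expand 3≤i i≤n 2≤j j≤n ⟩
      m i j - A i * (A j * Y j) - A i * Y i * A j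
        ≈⟨ +-congʳ (+-congʳ (trans (symmetric i j 1≤i i≤n 1≤j j≤n) (entry 2≤j j≤i i≤n))) ⟩
      A j * A i * (Y i - Y j) - A i * (A j * Y j) - A i * Y i * A j ≈⟨ collect _ _ _ _ ⟩
      - (A i * A j * Y j + A i * A j * Y j)                         ≈⟨ Δ-row₂ i j j ⟨
      Δ i j 2 j                                                     ≡⟨ cong (Δ i j 2) (ℕ.m≥n⇒m⊓n≡n j≤i) ⟨
      Δ i j 2 (i ⊓ j)                                               ∎
      where
      1≤i : 1 ≤ i
      1≤i = ℕ.≤-trans (s≤s z≤n) 3≤i
      1≤j : 1 ≤ j
      1≤j = ℕ.≤-trans (s≤s z≤n) 2≤j
      collect : ∀ a b y z → b * a * (y - z) - a * (b * z) - a * y * b ≈ - (a * b * z + a * b * z)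
      collect = solve 4
        (λ a b y z → b :* a :* (y :- z) :- a :* (b :* z) :- a :* y :* b := :- (a :* b :* z :+ a :* b :* z)) refl

    ClosedForm : ℕ → Set ℓ
    ClosedForm k = ∀ {i j} → 3 ≤ i → i ≤ n → 1 ≤ j → j ≤ n →
      mk m k i j ≈ Δ i j (k ⊓ (i ∸ 1) ⊓ j) (i ⊓ j)

    -- Column 1 is separate because Y 1 = B 1 / (A 2 · 0) is a junk value.
    closedForm₂ : ClosedForm 2
    closedForm₂ {i} {1} 3≤i@(s≤s (s≤s (s≤s _))) i≤n _ _ =
      trans (mk₂-column₁ 3≤i i≤n) (sym (Δ-diagonal i 1 1))
    closedForm₂ {j = 1+ (1+ _)} 3≤i@(s≤s (s≤s (s≤s _))) i≤n _ j≤n =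
      mk₂-closed 3≤i i≤n (s≤s (s≤s z≤n)) j≤n

    closedForm-suc : ∀ {k} → 2 ≤ k → ClosedForm k → ClosedForm (1+ k)
    closedForm-suc {k} 2≤k closed {i} {j} 3≤i i≤n 1≤j j≤n with i ℕ.≤? 1+ k
    ... | yes i≤k+1 = begin
      mk m (1+ k) i j                    ≡⟨ mk-suc-≤ m j 2≤k i≤k+1 ⟩
      mk m k i j                         ≈⟨ closed 3≤i i≤n 1≤j j≤n ⟩
      Δ i j (k ⊓ (i ∸ 1) ⊓ j) (i ⊓ j)    ≡⟨ cong (λ p → Δ i j (p ⊓ j) (i ⊓ j)) k⊓[i-1]≡k+1⊓[i-1] ⟩
      Δ i j (1+ k ⊓ (i ∸ 1) ⊓ j) (i ⊓ j) ∎
      where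
      i-1≤k : i ∸ 1 ≤ k
      i-1≤k = ℕ.∸-monoˡ-≤ 1 i≤k+1
      k⊓[i-1]≡k+1⊓[i-1] : k ⊓ (i ∸ 1) ≡ 1+ k ⊓ (i ∸ 1)
      k⊓[i-1]≡k+1⊓[i-1] =
        ≡.trans (ℕ.m≥n⇒m⊓n≡n i-1≤k) (≡.sym (ℕ.m≥n⇒m⊓n≡n (ℕ.m≤n⇒m≤1+n i-1≤k)))
    ... | no i≰k+1 = begin
      mk m (1+ k) i j                                    ≡⟨ mk-suc-> m j 2≤k k+1<i ⟩
      mk m k i j - A i / A (1+ k) * mk m k (1+ k) j      ≈⟨ +-cong row-i (-‿cong (*-congˡ row-k+1)) ⟩
      Δ i j (k ⊓ j) (i ⊓ j) - A i / A (1+ k) * Δ (1+ k) j (k ⊓ j) (1+ k ⊓ j)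
        ≈⟨ Δ-eliminate i j (1+ k) _ _ _ (A≉0 (ℕ.m≤n⇒m≤1+n 2≤k) k+1≤n) ⟩
      Δ i j (1+ k ⊓ j) (i ⊓ j)
        ≡⟨ cong (λ p → Δ i j (p ⊓ j) (i ⊓ j)) (ℕ.m≤n⇒m⊓n≡m k+1≤i-1) ⟨
      Δ i j (1+ k ⊓ (i ∸ 1) ⊓ j) (i ⊓ j)                 ∎
      where
      k+1<i : 1+ k < i
      k+1<i = ℕ.≰⇒> i≰k+1
      k+1≤i-1 : 1+ k ≤ i ∸ 1
      k+1≤i-1 = ℕ.∸-monoˡ-≤ 1 k+1<i
      k+1≤n : 1+ k ≤ n
      k+1≤n = ℕ.≤-trans (ℕ.<⇒≤ k+1<i) i≤n
      row-i : mk m k i j ≈ Δ i j (k ⊓ j) (i ⊓ j)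
      row-i = trans (closed 3≤i i≤n 1≤j j≤n)
        (reflexive (cong (λ p → Δ i j (p ⊓ j) (i ⊓ j)) (ℕ.m≤n⇒m⊓n≡m (ℕ.≤-trans (ℕ.n≤1+n k) k+1≤i-1))))
      row-k+1 : mk m k (1+ k) j ≈ Δ (1+ k) j (k ⊓ j) (1+ k ⊓ j)
      row-k+1 = trans (closed (s≤s 2≤k) k+1≤n 1≤j j≤n)
        (reflexive (cong (λ p → Δ (1+ k) j (p ⊓ j) (1+ k ⊓ j)) (ℕ.⊓-idem k)))

    closedForm : ∀ {k} → 2 ≤ k → ClosedForm k
    closedForm {1} (s≤s ())
    closedForm {2} _ = closedForm₂
    closedForm {1+ k@(1+ (1+ _))} _ = closedForm-suc 2≤k (closedForm 2≤k)
      where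
      2≤k : 2 ≤ k
      2≤k = s≤s (s≤s z≤n)

    mk-below-diagonal : ∀ {k i j} → 2 ≤ k → 3 ≤ i → i ≤ n → 1 ≤ j → j ≤ i ∸ 1 → j ≤ k →
      mk m k i j ≈ 0#
    mk-below-diagonal {k} {i} {j} 2≤k 3≤i i≤n 1≤j j≤i-1 j≤k = begin
      mk m k i j                      ≈⟨ closedForm 2≤k 3≤i i≤n 1≤j (ℕ.≤-trans j≤i i≤n) ⟩
      Δ i j (k ⊓ (i ∸ 1) ⊓ j) (i ⊓ j)
        ≡⟨ cong₂ (Δ i j) (ℕ.m≥n⇒m⊓n≡n (ℕ.⊓-glb j≤k j≤i-1)) (ℕ.m≥n⇒m⊓n≡n j≤i) ⟩
      Δ i j j j                       ≈⟨ Δ-diagonal i j j ⟩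
      0#                              ∎
      where
      j≤i : j ≤ i
      j≤i = ℕ.≤-trans j≤i-1 (ℕ.m∸n≤m i 1)

    mk-above-diagonal : ∀ {k i j} → 2 ≤ k → 3 ≤ i → i ≤ 1+ k → i ≤ j → j ≤ n →
      mk m k i j ≈ (- (ι 2 * A j)) / A (i ∸ 1) * m (i ∸ 1) i
    mk-above-diagonal {k} {1+ h} {j} 2≤k 3≤i@(s≤s 2≤h) i≤k+1 i≤j j≤n = begin
      mk m k (1+ h) j                    ≈⟨ closedForm 2≤k 3≤i i≤n (ℕ.≤-trans (s≤s z≤n) i≤j) j≤n ⟩
      Δ (1+ h) j (k ⊓ h ⊓ j) (1+ h ⊓ j)  ≡⟨ cong₂ (Δ (1+ h) j) k⊓h⊓j≡h (ℕ.m≤n⇒m⊓n≡m i≤j) ⟩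
      Δ (1+ h) j h (1+ h)                ≈⟨ Δ-superdiagonal j 2≤h i≤n ⟩
      (- (ι 2 * A j)) / A h * m h (1+ h) ∎
      where
      i≤n : 1+ h ≤ n
      i≤n = ℕ.≤-trans i≤j j≤n
      k⊓h⊓j≡h : k ⊓ h ⊓ j ≡ h
      k⊓h⊓j≡h = ≡.trans (cong (_⊓ j) (ℕ.m≥n⇒m⊓n≡n (ℕ.≤-pred i≤k+1))) (ℕ.m≤n⇒m⊓n≡m (ℕ.<⇒≤ i≤j))

lemma3p2 : ∀ {c ℓ} (F : Field c ℓ) → let open Field F in
    CharZero → (n : ℕ) → 1 ≤ n → (m : Mat) → IsFrieze n m →
    ∀ k → 3 ≤ k → k ≤ n ∸ 1 →
    ∀ i j → 1 ≤ i → i ≤ n → 1 ≤ j → j ≤ n →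
      (i ≤ 2 → mk m k i j ≈ mk m 2 i j)
      × (3 ≤ i → j ≤ i ∸ 1 → j ≤ k → mk m k i j ≈ 0#)
      × (3 ≤ i → i ≤ 1+ k → i ≤ j →
           mk m k i j ≈ ((- (ι 2 * m 1 j)) / m 1 (i ∸ 1)) * m (i ∸ 1) i)
      × (2 ℕ+ k ≤ i → 1+ k ≤ j →
           mk m k i j ≈ mk m 2 i j - sumFromTo 3 k (λ t → (m 1 i / m 1 t) * mk m (t ∸ 1) t j))
lemma3p2 F _ n _ m fr k 3≤k k≤n-1 i j _ i≤n 1≤j j≤n =
    (λ i≤2 → reflexive (mk-top-rows m j 2≤k i≤2))
  , (λ 3≤i j≤i-1 j≤k → mk-below-diagonal 2≤k 3≤i i≤n 1≤j j≤i-1 j≤k)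
  , (λ 3≤i i≤k+1 i≤j → mk-above-diagonal 2≤k 3≤i i≤k+1 i≤j j≤n)
  , (λ k+2≤i _ → mk-unfold m j 2≤k (ℕ.<⇒≤ k+2≤i))
  where
  open Field F using (reflexive)
  open Elimination F
  2≤k : 2 ≤ k
  2≤k = ℕ.≤-trans (ℕ.n≤1+n 2) 3≤k
  2≤n : 2 ≤ n
  2≤n = ℕ.≤-trans 2≤k (ℕ.≤-trans k≤n-1 (ℕ.m∸n≤m n 1))
  open FriezeCoordinates fr 2≤n
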